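{- For every $\sigma\in SC$, $\sigma\sim\mathrm{mcl}(\sigma)$, where $\mathrm{mcl}(\sigma)=\mathrm{mclo}(\sigma,\varepsilon)$ and $\varepsilon$ is the empty substitution.
   Context: Contract terms over base types $BT$ and labels: $\sigma ::= \mathbf{1} \mid ?t.\sigma \mid !t.\sigma \mid ?(\sigma').\sigma \mid !(\sigma').\sigma \mid \sum_{i\in I} ?l_i.\sigma_i \mid \bigoplus_{i\in I} !l_i.\sigma_i \mid \mu x.\sigma \mid x$ ($I$ finite nonempty, labels distinct; $!l.\sigma$ is the one-summand internal sum). $SC$ is the set of closed guarded terms (guarded: for every subterm $\mu x.\sigma$, every occurrence of $x$ in $\sigma$ lies under a constructor other than $\mu$). A substitution $s$ is a finite partial map from variables to closed terms; $\sigma s$ replaces free occurrences of $x\in\mathrm{dom}(s)$ by $s(x)$, with $(\mu y.\rho)s=\mu y.(\rho s')$ where $s'$ is $s$ with $y$ removed. $\mathrm{mclo}(\sigma,s)$ (for $\mathrm{fv}(\sigma)\subseteq\mathrm{dom}(s)$): $\mathrm{mclo}(\mathbf{1},s)=\mathbf{1}$; $\mathrm{mclo}(x,s)=x$; $\mathrm{mclo}(!(\sigma^m).\sigma',s)=!(\sigma^m s).\mathrm{mclo}(\sigma',s)$; $\mathrm{mclo}(?(\sigma^m).\sigma',s)=?(\sigma^m s).\mathrm{mclo}(\sigma',s)$; $\mathrm{mclo}(?t.\sigma',s)=?t.\mathrm{mclo}(\sigma',s)$; $\mathrm{mclo}(!t.\sigma',s)=!t.\mathrm{mclo}(\sigma',s)$;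 $\mathrm{mclo}(\sum_{i}?l_i.\sigma_i,s)=\sum_{i}?l_i.\mathrm{mclo}(\sigma_i,s)$; $\mathrm{mclo}(\bigoplus_i!l_i.\sigma_i,s)=\bigoplus_i!l_i.\mathrm{mclo}(\sigma_i,s)$; $\mathrm{mclo}(\mu x.\sigma',s)=\mu x.\mathrm{mclo}(\sigma',s')$ where $s'$ maps $x$ to $(\mu x.\sigma')s$ and agrees with $s$ elsewhere. Transitions: $\mathbf{1}\xrightarrow{\mathsf{ok}}$; $\lambda.\sigma\xrightarrow{\lambda}\sigma$ for prefixes $\lambda\in\{?l,!l,?t,!t,?(\sigma'),!(\sigma')\}$; $\sum_{i\in I}?l_i.\sigma_i\xrightarrow{?l_k}\sigma_k$; $\bigoplus_{i\in I}!l_i.\sigma_i\xrightarrow{\tau}!l_k.\sigma_k$ when $|I|>1$; $\mu x.\sigma\xrightarrow{\tau}\sigma\{\mu x.\sigma/x\}$; nothing else. A strong bisimulation is a relation $R$ on $SC$ such that whenever $\sigma_1R\sigma_2$: $\sigma_1\xrightarrow{\mathsf{ok}}$ iff $\sigma_2\xrightarrow{\mathsf{ok}}$, and for every action or $\tau$ label $\mu$, $\sigma_1\xrightarrow{\mu}\sigma_1'$ implies $\sigma_2\xrightarrow{\mu}\sigma_2'$ with $\sigma_1'R\sigma_2'$, and symmetrically; $\sim$ is the union of all strong bisimulations. -}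

module Defs where

open import Data.Nat using (ℕ; _≟_)
open import Data.List using (List; []; _∷_)
open import Data.Maybe using (Maybe; just; nothing)
open import Data.Product using (_×_; _,_; ∃)
open import Data.Sum using (_⊎_)
open import Data.Empty using (⊥)
open import Data.Unit using (⊤)
open import Relation.Nullary using (¬_; yes; no)
open import Relation.Binary.PropositionalEquality using (_≡_; _≢_)
open import Data.List.Relation.Unary.Unique.Propositional using (Unique)

-- Variables are natural numbers; BT = base types, L = labels (arbitrary sets).
mutual
  data Term (BT L : Set) : Set where
    end  : Term BT L                               -- 1
    inT  : BT → Term BT L → Term BT L
    outT : BT → Term BT L → Term BT L
    inS  : Term BT L → Term BT L → Term BT L
    outS : Term BT L → Term BT L → Term BT L
    ext  : L → Term BT L → Alts BT L → Term BT L   -- Σ ?l_i.σ_i (first summand, rest)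
    int  : L → Term BT L → Alts BT L → Term BT L   -- ⊕ !l_i.σ_i (first summand, rest)
    mu   : ℕ → Term BT L → Term BT L
    var  : ℕ → Term BT L

  data Alts (BT L : Set) : Set where
    []  : Alts BT L
    alt : L → Term BT L → Alts BT L → Alts BT L

data Act (BT L : Set) : Set where
  inL  : L → Act BT L
  outL : L → Act BT L
  inTy  : BT → Act BT L
  outTy : BT → Act BT L
  inSe  : Term BT L → Act BT L
  outSe : Term BT L → Act BT L

data Lab (BT L : Set) : Set where
  τ   : Lab BT L
  act : Act BT L → Lab BT L

-- Substitutions: finite partial maps, as association lists (first binding wins).
Subst : Set → Set → Set
Subst BT L = List (ℕ × Term BT L)

module _ {BT L : Set} where

  lookupS : Subst BT L → ℕ → Maybe (Term BT L)
  lookupS [] x = nothing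
  lookupS ((y , t) ∷ s) x with x ≟ y
  ... | yes _ = just t
  ... | no _  = lookupS s x

  removeS : ℕ → Subst BT L → Subst BT L
  removeS x [] = []
  removeS x ((y , t) ∷ s) with x ≟ y
  ... | yes _ = removeS x s
  ... | no _  = (y , t) ∷ removeS x s

  mutual
    sub : Term BT L → Subst BT L → Term BT L
    sub end s = end
    sub (inT t σ) s = inT t (sub σ s)
    sub (outT t σ) s = outT t (sub σ s)
    sub (inS m σ) s = inS (sub m s) (sub σ s)
    sub (outS m σ) s = outS (sub m s) (sub σ s)
    sub (ext l σ as) s = ext l (sub σ s) (subA as s)
    sub (int l σ as) s = int l (sub σ s) (subA as s)
    sub (mu y ρ) s = mu y (sub ρ (removeS y s))
    sub (var x) s with lookupS s x
    ... | just t  = t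
    ... | nothing = var x

    subA : Alts BT L → Subst BT L → Alts BT L
    subA [] s = []
    subA (alt l σ as) s = alt l (sub σ s) (subA as s)

  mutual
    mclo : Term BT L → Subst BT L → Term BT L
    mclo end s = end
    mclo (var x) s = var x
    mclo (outS m σ) s = outS (sub m s) (mclo σ s)
    mclo (inS m σ) s = inS (sub m s) (mclo σ s)
    mclo (inT t σ) s = inT t (mclo σ s)
    mclo (outT t σ) s = outT t (mclo σ s)
    mclo (ext l σ as) s = ext l (mclo σ s) (mcloA as s)
    mclo (int l σ as) s = int l (mclo σ s) (mcloA as s)
    mclo (mu x σ) s = mu x (mclo σ ((x , sub (mu x σ) s) ∷ s))

    mcloA : Alts BT L → Subst BT L → Alts BT L
    mcloA [] s = []
    mcloA (alt l σ as) s = alt l (mclo σ s) (mcloA as s)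

  mcl : Term BT L → Term BT L
  mcl σ = mclo σ []

  mutual
    data FV (x : ℕ) : Term BT L → Set where
      fv-var  : FV x (var x)
      fv-inT  : ∀ {t σ} → FV x σ → FV x (inT t σ)
      fv-outT : ∀ {t σ} → FV x σ → FV x (outT t σ)
      fv-inS₁ : ∀ {m σ} → FV x m → FV x (inS m σ)
      fv-inS₂ : ∀ {m σ} → FV x σ → FV x (inS m σ)
      fv-outS₁ : ∀ {m σ} → FV x m → FV x (outS m σ)
      fv-outS₂ : ∀ {m σ} → FV x σ → FV x (outS m σ)
      fv-ext₁ : ∀ {l σ as} → FV x σ → FV x (ext l σ as)
      fv-ext₂ : ∀ {l σ as} → FVA x as → FV x (ext l σ as)
      fv-int₁ : ∀ {l σ as} → FV x σ → FV x (int l σ as)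
      fv-int₂ : ∀ {l σ as} → FVA x as → FV x (int l σ as)
      fv-mu   : ∀ {y σ} → x ≢ y → FV x σ → FV x (mu y σ)

    data FVA (x : ℕ) : Alts BT L → Set where
      fva-here  : ∀ {l σ as} → FV x σ → FVA x (alt l σ as)
      fva-there : ∀ {l σ as} → FVA x as → FVA x (alt l σ as)

  Closed : Term BT L → Set
  Closed σ = ∀ x → ¬ FV x σ

  Unguarded : ℕ → Term BT L → Set
  Unguarded x (var y) = x ≡ y
  Unguarded x (mu y σ) = x ≢ y × Unguarded x σ
  Unguarded x _ = ⊥

  mutual
    Guarded : Term BT L → Set
    Guarded end = ⊤
    Guarded (var x) = ⊤
    Guarded (inT t σ) = Guarded σ
    Guarded (outT t σ) = Guarded σ
    Guarded (inS m σ) = Guarded m × Guarded σ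
    Guarded (outS m σ) = Guarded m × Guarded σ
    Guarded (ext l σ as) = Guarded σ × GuardedA as
    Guarded (int l σ as) = Guarded σ × GuardedA as
    Guarded (mu x σ) = ¬ Unguarded x σ × Guarded σ

    GuardedA : Alts BT L → Set
    GuardedA [] = ⊤
    GuardedA (alt l σ as) = Guarded σ × GuardedA as

  labels : Alts BT L → List L
  labels [] = []
  labels (alt l σ as) = l ∷ labels as

  mutual
    Distinct : Term BT L → Set
    Distinct end = ⊤
    Distinct (var x) = ⊤
    Distinct (inT t σ) = Distinct σ
    Distinct (outT t σ) = Distinct σ
    Distinct (inS m σ) = Distinct m × Distinct σ
    Distinct (outS m σ) = Distinct m × Distinct σ
    Distinct (ext l σ as) = Unique (l ∷ labels as) × Distinct σ × DistinctA as
    Distinct (int l σ as) = Unique (l ∷ labels as) × Distinct σ × DistinctA as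
    Distinct (mu x σ) = Distinct σ

    DistinctA : Alts BT L → Set
    DistinctA [] = ⊤
    DistinctA (alt l σ as) = Distinct σ × DistinctA as

  SC : Term BT L → Set
  SC σ = Closed σ × Guarded σ × Distinct σ

  data InAlts (l : L) (σ : Term BT L) : Alts BT L → Set where
    here  : ∀ {as} → InAlts l σ (alt l σ as)
    there : ∀ {l' σ' as} → InAlts l σ as → InAlts l σ (alt l' σ' as)

  data Ok : Term BT L → Set where
    ok-end : Ok end

  data _⟶[_]_ : Term BT L → Lab BT L → Term BT L → Set where
    t-inT  : ∀ {t σ} → inT t σ ⟶[ act (inTy t) ] σ
    t-outT : ∀ {t σ} → outT t σ ⟶[ act (outTy t) ] σ
    t-inS  : ∀ {m σ} → inS m σ ⟶[ act (inSe m) ] σ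
    t-outS : ∀ {m σ} → outS m σ ⟶[ act (outSe m) ] σ
    t-ext-head : ∀ {l σ as} → ext l σ as ⟶[ act (inL l) ] σ
    t-ext-tail : ∀ {l σ as l' σ'} → InAlts l' σ' as → ext l σ as ⟶[ act (inL l') ] σ'
    t-out  : ∀ {l σ} → int l σ [] ⟶[ act (outL l) ] σ          -- !l.σ
    t-int-head : ∀ {l σ l₁ σ₁ as} →
      int l σ (alt l₁ σ₁ as) ⟶[ τ ] int l σ []
    t-int-tail : ∀ {l σ l₁ σ₁ as l' σ'} → InAlts l' σ' (alt l₁ σ₁ as) →
      int l σ (alt l₁ σ₁ as) ⟶[ τ ] int l' σ' []
    t-mu   : ∀ {x σ} → mu x σ ⟶[ τ ] sub σ ((x , mu x σ) ∷ [])

  record IsStrongBisim (R : Term BT L → Term BT L → Set) : Set where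
    field
      inSC : ∀ {a b} → R a b → SC a × SC b
      okL  : ∀ {a b} → R a b → Ok a → Ok b
      okR  : ∀ {a b} → R a b → Ok b → Ok a
      fwd  : ∀ {a b a' μ} → R a b → a ⟶[ μ ] a' → ∃ λ b' → (b ⟶[ μ ] b') × R a' b'
      bwd  : ∀ {a b b' μ} → R a b → b ⟶[ μ ] b' → ∃ λ a' → (a ⟶[ μ ] a') × R a' b'

  _∼_ : Term BT L → Term BT L → Set₁
  a ∼ b = ∃ λ (R : Term BT L → Term BT L → Set) → IsStrongBisim R × R a b

-- Consider pairs (ρ s , mclo(ρ, s) t) in which s and t are environments built by unfolding the
-- same μ-binders on both sides, t binding each variable to the mclo-image of what s binds it to.
-- These pairs form a strong bisimulation: prefixes and sums are matched constructor by constructor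
-- (message types are closed, so mclo has already substituted them completely), a μ-unfolding on one
-- side is answered by the μ-unfolding on the other side and extends both environments by the same
-- binder, and a bound variable stands for μ-terms on both sides, so it behaves like the μ case.
-- Taking ρ = σ and s = t = ε gives σ ∼ mcl σ; the side condition that the relation lives in SC
-- amounts to showing that unfolding and mclo preserve closedness, guardedness and distinct labels.
module Submission where

open import Defs
open import Data.Nat using (ℕ; _≟_)
open import Data.List using ([]; _∷_)
import Data.List.Relation.Unary.All as All
open All using (All; []; _∷_)
open import Data.List.Relation.Unary.All.Properties using (All¬⇒¬Any)
import Data.List.Relation.Unary.Any as Any
open Any using (Any)
open import Data.List.Relation.Unary.Unique.Propositional using (Unique)
import Data.List.Relation.Unary.AllPairs as AllPairs
open import Data.Maybe using (just; nothing)
open import Data.Product as Prod using (_×_; _,_; ∃; proj₁; proj₂)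
open import Data.Sum as Sum using (_⊎_; inj₁; inj₂)
open import Data.Unit using (tt)
open import Function using (_∘_)
open import Relation.Nullary using (¬_; yes; no; contradiction)
open import Relation.Binary.PropositionalEquality
  using (_≡_; _≢_; refl; sym; trans; cong; cong₂; subst; subst₂)

module _ {BT L : Set} where

  private
    Tm = Term BT L
    Sb = Subst BT L

  lookup-there : ∀ {x z} (c : Tm) (s : Sb) → z ≢ x → lookupS ((x , c) ∷ s) z ≡ lookupS s z
  lookup-there {x} {z} c s z≢x with z ≟ x
  ... | yes z≡x = contradiction z≡x z≢x
  ... | no _ = refl

  remove-here : ∀ {x z} {v : Tm} (s : Sb) → x ≡ z → removeS x ((z , v) ∷ s) ≡ removeS x s
  remove-here {x} {z} s x≡z with x ≟ z
  ... | yes _ = refl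
  ... | no x≢z = contradiction x≡z x≢z

  remove-there : ∀ {x z} {v : Tm} (s : Sb) → x ≢ z → removeS x ((z , v) ∷ s) ≡ (z , v) ∷ removeS x s
  remove-there {x} {z} s x≢z with x ≟ z
  ... | yes x≡z = contradiction x≡z x≢z
  ... | no _ = refl

  lookup-remove-self : ∀ y (s : Sb) → lookupS (removeS y s) y ≡ nothing
  lookup-remove-self y [] = refl
  lookup-remove-self y ((z , v) ∷ s) with y ≟ z
  ... | yes _ = lookup-remove-self y s
  ... | no y≢z = trans (lookup-there v (removeS y s) y≢z) (lookup-remove-self y s)

  lookup-remove-other : ∀ {x y} (s : Sb) → x ≢ y → lookupS (removeS y s) x ≡ lookupS s x
  lookup-remove-other [] _ = refl
  lookup-remove-other {x} {y} ((z , v) ∷ s) x≢y with y ≟ z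
  ... | yes refl = trans (lookup-remove-other s x≢y) (sym (lookup-there v s x≢y))
  ... | no _ with x ≟ z
  ...   | yes _ = refl
  ...   | no _ = lookup-remove-other s x≢y

  remove-idem : ∀ x (s : Sb) → removeS x (removeS x s) ≡ removeS x s
  remove-idem x [] = refl
  remove-idem x ((z , v) ∷ s) with x ≟ z
  ... | yes _ = remove-idem x s
  ... | no x≢z = trans (remove-there (removeS x s) x≢z) (cong ((z , v) ∷_) (remove-idem x s))

  remove-comm : ∀ x y (s : Sb) → removeS y (removeS x s) ≡ removeS x (removeS y s)
  remove-comm x y [] = refl
  remove-comm x y ((z , v) ∷ s) with x ≟ z | y ≟ z
  ... | yes _   | yes _   = remove-comm x y s
  ... | yes x≡z | no _    = trans (remove-comm x y s) (sym (remove-here (removeS y s) x≡z))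
  ... | no _    | yes y≡z = trans (remove-here (removeS x s) y≡z) (remove-comm x y s)
  ... | no x≢z  | no y≢z  =
    trans (remove-there (removeS x s) y≢z)
          (trans (cong ((z , v) ∷_) (remove-comm x y s)) (sym (remove-there (removeS y s) x≢z)))

  lookup-All : ∀ {P : Tm → Set} {s : Sb} {z v} → All (P ∘ proj₂) s → lookupS s z ≡ just v → P v
  lookup-All {s = (y , w) ∷ s} {z} (pw ∷ ps) eq with z ≟ y
  lookup-All (pw ∷ ps) refl | yes _ = pw
  ... | no _ = lookup-All ps eq

  lookup-Any : ∀ {P : Tm → Set} {s : Sb} {z v} → lookupS s z ≡ just v → P v → Any (P ∘ proj₂) s
  lookup-Any {s = (y , w) ∷ s} {z} eq pv with z ≟ y
  lookup-Any refl pv | yes _ = Any.here pv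
  ... | no _ = Any.there (lookup-Any eq pv)

  remove-All : ∀ {P : ℕ × Tm → Set} y {s : Sb} → All P s → All P (removeS y s)
  remove-All y [] = []
  remove-All y {(z , v) ∷ s} (p ∷ ps) with y ≟ z
  ... | yes _ = remove-All y ps
  ... | no _ = p ∷ remove-All y ps

  remove-Any : ∀ {P : ℕ × Tm → Set} y {s : Sb} → Any P (removeS y s) → Any P s
  remove-Any y {(z , v) ∷ s} p with y ≟ z
  ... | yes _ = Any.there (remove-Any y p)
  remove-Any y (Any.here p)  | no _ = Any.here p
  remove-Any y (Any.there p) | no _ = Any.there (remove-Any y p)

  sub-var-just : ∀ {z} {v : Tm} (s : Sb) → lookupS s z ≡ just v → sub (var z) s ≡ v
  sub-var-just s eq rewrite eq = refl

  sub-var-nothing : ∀ {z} (s : Sb) → lookupS s z ≡ nothing → sub (var z) s ≡ var z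
  sub-var-nothing s eq rewrite eq = refl

  sub-var-here : ∀ x (v : Tm) (s : Sb) → sub (var x) ((x , v) ∷ s) ≡ v
  sub-var-here x v s with x ≟ x
  ... | yes _ = refl
  ... | no x≢x = contradiction refl x≢x

  sub-var-there : ∀ {x z} (v : Tm) (s : Sb) → z ≢ x → sub (var z) ((x , v) ∷ s) ≡ sub (var z) s
  sub-var-there {x} {z} v s z≢x with z ≟ x
  ... | yes z≡x = contradiction z≡x z≢x
  ... | no _ = refl

  mutual
    sub-unbound : ∀ (u : Tm) (s : Sb) → (∀ {x} → FV x u → lookupS s x ≡ nothing) → sub u s ≡ u
    sub-unbound end s h = refl
    sub-unbound (inT b u) s h = cong (inT b) (sub-unbound u s (h ∘ fv-inT))
    sub-unbound (outT b u) s h = cong (outT b) (sub-unbound u s (h ∘ fv-outT))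
    sub-unbound (inS m u) s h =
      cong₂ inS (sub-unbound m s (h ∘ fv-inS₁)) (sub-unbound u s (h ∘ fv-inS₂))
    sub-unbound (outS m u) s h =
      cong₂ outS (sub-unbound m s (h ∘ fv-outS₁)) (sub-unbound u s (h ∘ fv-outS₂))
    sub-unbound (ext l u as) s h =
      cong₂ (ext l) (sub-unbound u s (h ∘ fv-ext₁)) (subA-unbound as s (h ∘ fv-ext₂))
    sub-unbound (int l u as) s h =
      cong₂ (int l) (sub-unbound u s (h ∘ fv-int₁)) (subA-unbound as s (h ∘ fv-int₂))
    sub-unbound (mu y u) s h = cong (mu y) (sub-unbound u (removeS y s) h′)
      where
      h′ : ∀ {x} → FV x u → lookupS (removeS y s) x ≡ nothing
      h′ {x} p with x ≟ y
      ... | yes refl = lookup-remove-self x s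
      ... | no x≢y = trans (lookup-remove-other s x≢y) (h (fv-mu x≢y p))
    sub-unbound (var z) s h = sub-var-nothing s (h fv-var)

    subA-unbound : ∀ (as : Alts BT L) (s : Sb) → (∀ {x} → FVA x as → lookupS s x ≡ nothing) →
                   subA as s ≡ as
    subA-unbound [] s h = refl
    subA-unbound (alt l u as) s h =
      cong₂ (alt l) (sub-unbound u s (h ∘ fva-here)) (subA-unbound as s (h ∘ fva-there))

  sub-closed : ∀ {u : Tm} (s : Sb) → Closed u → sub u s ≡ u
  sub-closed {u} s cl = sub-unbound u s (λ {x} p → contradiction p (cl x))

  sub-[] : ∀ (u : Tm) → sub u [] ≡ u
  sub-[] u = sub-unbound u [] (λ _ → refl)

  mutual
    FV-sub : ∀ {x} (u : Tm) (s : Sb) → FV x (sub u s) →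
             (FV x u × lookupS s x ≡ nothing) ⊎ Any (FV x ∘ proj₂) s
    FV-sub (inT b u) s (fv-inT p) = Sum.map₁ (Prod.map₁ fv-inT) (FV-sub u s p)
    FV-sub (outT b u) s (fv-outT p) = Sum.map₁ (Prod.map₁ fv-outT) (FV-sub u s p)
    FV-sub (inS m u) s (fv-inS₁ p) = Sum.map₁ (Prod.map₁ fv-inS₁) (FV-sub m s p)
    FV-sub (inS m u) s (fv-inS₂ p) = Sum.map₁ (Prod.map₁ fv-inS₂) (FV-sub u s p)
    FV-sub (outS m u) s (fv-outS₁ p) = Sum.map₁ (Prod.map₁ fv-outS₁) (FV-sub m s p)
    FV-sub (outS m u) s (fv-outS₂ p) = Sum.map₁ (Prod.map₁ fv-outS₂) (FV-sub u s p)
    FV-sub (ext l u as) s (fv-ext₁ p) = Sum.map₁ (Prod.map₁ fv-ext₁) (FV-sub u s p)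
    FV-sub (ext l u as) s (fv-ext₂ p) = Sum.map₁ (Prod.map₁ fv-ext₂) (FVA-sub as s p)
    FV-sub (int l u as) s (fv-int₁ p) = Sum.map₁ (Prod.map₁ fv-int₁) (FV-sub u s p)
    FV-sub (int l u as) s (fv-int₂ p) = Sum.map₁ (Prod.map₁ fv-int₂) (FVA-sub as s p)
    FV-sub (mu y u) s (fv-mu x≢y p) =
      Sum.map (Prod.map (fv-mu x≢y) (trans (sym (lookup-remove-other s x≢y)))) (remove-Any y)
              (FV-sub u (removeS y s) p)
    FV-sub (var z) s p with lookupS s z in eq
    ... | just v = inj₂ (lookup-Any eq p)
    ... | nothing with p
    ...   | fv-var = inj₁ (fv-var , eq)

    FVA-sub : ∀ {x} (as : Alts BT L) (s : Sb) → FVA x (subA as s) →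
              (FVA x as × lookupS s x ≡ nothing) ⊎ Any (FV x ∘ proj₂) s
    FVA-sub (alt l u as) s (fva-here p) = Sum.map₁ (Prod.map₁ fva-here) (FV-sub u s p)
    FVA-sub (alt l u as) s (fva-there p) = Sum.map₁ (Prod.map₁ fva-there) (FVA-sub as s p)

  SCEnv : Sb → Set
  SCEnv = All (SC ∘ proj₂)

  SCEnv-⇒-¬FV : ∀ {x} {s : Sb} → SCEnv s → ¬ Any (FV x ∘ proj₂) s
  SCEnv-⇒-¬FV {x} g = All¬⇒¬Any (All.map (λ sc → proj₁ sc x) g)

  InScope : Tm → Sb → Set
  InScope u s = ∀ {x} → FV x u → lookupS s x ≢ nothing

  InScopeA : Alts BT L → Sb → Set
  InScopeA as s = ∀ {x} → FVA x as → lookupS s x ≢ nothing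

  Closed⇒InScope : ∀ {u : Tm} (s : Sb) → Closed u → InScope u s
  Closed⇒InScope s cl {x} p _ = cl x p

  InScope-mu : ∀ y (u : Tm) {s : Sb} (v : Tm) → InScope (mu y u) s → InScope u ((y , v) ∷ s)
  InScope-mu y u v sc {x} p eq with x ≟ y
  InScope-mu y u v sc p () | yes _
  ... | no x≢y = sc (fv-mu x≢y p) eq

  Closed-sub : ∀ (u : Tm) {s : Sb} → SCEnv s → InScope u s → Closed (sub u s)
  Closed-sub u {s} g sc x p with FV-sub u s p
  ... | inj₁ (q , eq) = sc q eq
  ... | inj₂ a = SCEnv-⇒-¬FV g a

  Unguarded⇒FV : ∀ {x} (u : Tm) → Unguarded x u → FV x u
  Unguarded⇒FV (var y) refl = fv-var
  Unguarded⇒FV (mu y u) (x≢y , p) = fv-mu x≢y (Unguarded⇒FV u p)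

  Unguarded-sub : ∀ {z} (u : Tm) {s : Sb} → SCEnv s → Unguarded z (sub u s) → Unguarded z u
  Unguarded-sub (mu y u) g (z≢y , p) = z≢y , Unguarded-sub u (remove-All y g) p
  Unguarded-sub (var w) {s} g p with lookupS s w in eq
  ... | just v = contradiction (Unguarded⇒FV v p) (proj₁ (lookup-All g eq) _)
  ... | nothing = p

  mutual
    Guarded-sub : ∀ (u : Tm) {s : Sb} → SCEnv s → Guarded u → Guarded (sub u s)
    Guarded-sub end g h = tt
    Guarded-sub (inT _ u) g h = Guarded-sub u g h
    Guarded-sub (outT _ u) g h = Guarded-sub u g h
    Guarded-sub (inS m u) g (hm , hu) = Guarded-sub m g hm , Guarded-sub u g hu
    Guarded-sub (outS m u) g (hm , hu) = Guarded-sub m g hm , Guarded-sub u g hu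
    Guarded-sub (ext l u as) g (hu , has) = Guarded-sub u g hu , GuardedA-sub as g has
    Guarded-sub (int l u as) g (hu , has) = Guarded-sub u g hu , GuardedA-sub as g has
    Guarded-sub (mu y u) g (¬ung , h) =
      ¬ung ∘ Unguarded-sub u (remove-All y g) , Guarded-sub u (remove-All y g) h
    Guarded-sub (var w) {s} g h with lookupS s w in eq
    ... | just v = proj₁ (proj₂ (lookup-All g eq))
    ... | nothing = tt

    GuardedA-sub : ∀ (as : Alts BT L) {s : Sb} → SCEnv s → GuardedA as → GuardedA (subA as s)
    GuardedA-sub [] g h = tt
    GuardedA-sub (alt l u as) g (hu , has) = Guarded-sub u g hu , GuardedA-sub as g has

  labels-subA : ∀ (as : Alts BT L) (s : Sb) → labels (subA as s) ≡ labels as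
  labels-subA [] s = refl
  labels-subA (alt l u as) s = cong (l ∷_) (labels-subA as s)

  labels-mcloA : ∀ (as : Alts BT L) (s : Sb) → labels (mcloA as s) ≡ labels as
  labels-mcloA [] s = refl
  labels-mcloA (alt l u as) s = cong (l ∷_) (labels-mcloA as s)

  mutual
    Distinct-sub : ∀ (u : Tm) {s : Sb} → SCEnv s → Distinct u → Distinct (sub u s)
    Distinct-sub end g h = tt
    Distinct-sub (inT _ u) g h = Distinct-sub u g h
    Distinct-sub (outT _ u) g h = Distinct-sub u g h
    Distinct-sub (inS m u) g (hm , hu) = Distinct-sub m g hm , Distinct-sub u g hu
    Distinct-sub (outS m u) g (hm , hu) = Distinct-sub m g hm , Distinct-sub u g hu
    Distinct-sub (ext l u as) {s} g (uq , hu , has) =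
      subst (Unique ∘ (l ∷_)) (sym (labels-subA as s)) uq , Distinct-sub u g hu , DistinctA-sub as g has
    Distinct-sub (int l u as) {s} g (uq , hu , has) =
      subst (Unique ∘ (l ∷_)) (sym (labels-subA as s)) uq , Distinct-sub u g hu , DistinctA-sub as g has
    Distinct-sub (mu y u) g h = Distinct-sub u (remove-All y g) h
    Distinct-sub (var w) {s} g h with lookupS s w in eq
    ... | just v = proj₂ (proj₂ (lookup-All g eq))
    ... | nothing = tt

    DistinctA-sub : ∀ (as : Alts BT L) {s : Sb} → SCEnv s → DistinctA as → DistinctA (subA as s)
    DistinctA-sub [] g h = tt
    DistinctA-sub (alt l u as) g (hu , has) = Distinct-sub u g hu , DistinctA-sub as g has

  SC-sub : ∀ (u : Tm) {s : Sb} → SCEnv s → InScope u s → Guarded u → Distinct u → SC (sub u s)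
  SC-sub u g sc gu du = Closed-sub u g sc , Guarded-sub u g gu , Distinct-sub u g du

  InAlts⇒FVA : ∀ {l x} {σ : Tm} {as} → InAlts l σ as → FV x σ → FVA x as
  InAlts⇒FVA here p = fva-here p
  InAlts⇒FVA (there i) p = fva-there (InAlts⇒FVA i p)

  InAlts-Guarded : ∀ {l} {σ : Tm} {as} → InAlts l σ as → GuardedA as → Guarded σ
  InAlts-Guarded here (g , _) = g
  InAlts-Guarded (there i) (_ , g) = InAlts-Guarded i g

  InAlts-Distinct : ∀ {l} {σ : Tm} {as} → InAlts l σ as → DistinctA as → Distinct σ
  InAlts-Distinct here (d , _) = d
  InAlts-Distinct (there i) (_ , d) = InAlts-Distinct i d

  InAlts-subA : ∀ {l} {ρ : Tm} {as} {s : Sb} → InAlts l ρ as → InAlts l (sub ρ s) (subA as s)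
  InAlts-subA here = here
  InAlts-subA (there i) = there (InAlts-subA i)

  InAlts-mcloA : ∀ {l} {ρ : Tm} {as} {s : Sb} → InAlts l ρ as → InAlts l (mclo ρ s) (mcloA as s)
  InAlts-mcloA here = here
  InAlts-mcloA (there i) = there (InAlts-mcloA i)

  InAlts-subA⁻ : ∀ (as : Alts BT L) {l σ} {s : Sb} → InAlts l σ (subA as s) →
                 ∃ λ ρ → InAlts l ρ as × σ ≡ sub ρ s
  InAlts-subA⁻ (alt l u as) here = u , here , refl
  InAlts-subA⁻ (alt l u as) (there i) = Prod.map₂ (Prod.map₁ there) (InAlts-subA⁻ as i)

  InAlts-mcloA⁻ : ∀ (as : Alts BT L) {l σ} {s : Sb} → InAlts l σ (mcloA as s) →
                  ∃ λ ρ → InAlts l ρ as × σ ≡ mclo ρ s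
  InAlts-mcloA⁻ (alt l u as) here = u , here , refl
  InAlts-mcloA⁻ (alt l u as) (there i) = Prod.map₂ (Prod.map₁ there) (InAlts-mcloA⁻ as i)

  SC-out : ∀ {l} {σ : Tm} → SC σ → SC (int l σ [])
  SC-out (c , g , d) = c′ , (g , tt) , (All.[] AllPairs.∷ AllPairs.[] , d , tt)
    where
    c′ : Closed (int _ _ [])
    c′ x (fv-int₁ p) = c x p

  step-preserves-SC : ∀ {a a' : Tm} {μ} → SC a → a ⟶[ μ ] a' → SC a'
  step-preserves-SC (c , g , d) t-inT = (λ x → c x ∘ fv-inT) , g , d
  step-preserves-SC (c , g , d) t-outT = (λ x → c x ∘ fv-outT) , g , d
  step-preserves-SC (c , (_ , g) , (_ , d)) t-inS = (λ x → c x ∘ fv-inS₂) , g , d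
  step-preserves-SC (c , (_ , g) , (_ , d)) t-outS = (λ x → c x ∘ fv-outS₂) , g , d
  step-preserves-SC (c , (g , _) , (_ , d , _)) t-ext-head = (λ x → c x ∘ fv-ext₁) , g , d
  step-preserves-SC (c , (_ , g) , (_ , _ , d)) (t-ext-tail i) =
    (λ x → c x ∘ fv-ext₂ ∘ InAlts⇒FVA i) , InAlts-Guarded i g , InAlts-Distinct i d
  step-preserves-SC (c , (g , _) , (_ , d , _)) t-out = (λ x → c x ∘ fv-int₁) , g , d
  step-preserves-SC (c , (g , _) , (_ , d , _)) t-int-head = SC-out ((λ x → c x ∘ fv-int₁) , g , d)
  step-preserves-SC (c , (_ , g) , (_ , _ , d)) (t-int-tail i) =
    SC-out ((λ x → c x ∘ fv-int₂ ∘ InAlts⇒FVA i) , InAlts-Guarded i g , InAlts-Distinct i d)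
  step-preserves-SC {mu x σ} sc@(c , (_ , g) , d) t-mu =
    SC-sub σ (sc ∷ []) (InScope-mu x σ (mu x σ) (Closed⇒InScope [] c)) g d

  mutual
    FV-mclo : ∀ {x} (u : Tm) (s : Sb) → FV x (mclo u s) → FV x u ⊎ Any (FV x ∘ proj₂) s
    FV-mclo (var z) s p = inj₁ p
    FV-mclo (inT b u) s (fv-inT p) = Sum.map₁ fv-inT (FV-mclo u s p)
    FV-mclo (outT b u) s (fv-outT p) = Sum.map₁ fv-outT (FV-mclo u s p)
    FV-mclo (inS m u) s (fv-inS₁ p) = Sum.map₁ (fv-inS₁ ∘ proj₁) (FV-sub m s p)
    FV-mclo (inS m u) s (fv-inS₂ p) = Sum.map₁ fv-inS₂ (FV-mclo u s p)
    FV-mclo (outS m u) s (fv-outS₁ p) = Sum.map₁ (fv-outS₁ ∘ proj₁) (FV-sub m s p)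
    FV-mclo (outS m u) s (fv-outS₂ p) = Sum.map₁ fv-outS₂ (FV-mclo u s p)
    FV-mclo (ext l u as) s (fv-ext₁ p) = Sum.map₁ fv-ext₁ (FV-mclo u s p)
    FV-mclo (ext l u as) s (fv-ext₂ p) = Sum.map₁ fv-ext₂ (FVA-mclo as s p)
    FV-mclo (int l u as) s (fv-int₁ p) = Sum.map₁ fv-int₁ (FV-mclo u s p)
    FV-mclo (int l u as) s (fv-int₂ p) = Sum.map₁ fv-int₂ (FVA-mclo as s p)
    FV-mclo (mu y u) s (fv-mu x≢y p) with FV-mclo u ((y , sub (mu y u) s) ∷ s) p
    ... | inj₁ q = inj₁ (fv-mu x≢y q)
    ... | inj₂ (Any.here q) = Sum.map₁ proj₁ (FV-sub (mu y u) s q)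
    ... | inj₂ (Any.there a) = inj₂ a

    FVA-mclo : ∀ {x} (as : Alts BT L) (s : Sb) → FVA x (mcloA as s) → FVA x as ⊎ Any (FV x ∘ proj₂) s
    FVA-mclo (alt l u as) s (fva-here p) = Sum.map₁ fva-here (FV-mclo u s p)
    FVA-mclo (alt l u as) s (fva-there p) = Sum.map₁ fva-there (FVA-mclo as s p)

  Closed-mcl : ∀ {σ : Tm} → Closed σ → Closed (mcl σ)
  Closed-mcl {σ} c x p with FV-mclo σ [] p
  ... | inj₁ q = c x q

  Unguarded-mclo : ∀ {z} (u : Tm) (s : Sb) → Unguarded z (mclo u s) → Unguarded z u
  Unguarded-mclo (var w) s p = p
  Unguarded-mclo (mu y u) s (z≢y , p) = z≢y , Unguarded-mclo u _ p

  SCEnv-mu : ∀ y (u : Tm) {s : Sb} → SCEnv s → InScope (mu y u) s → Guarded (mu y u) → Distinct u →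
             SCEnv ((y , sub (mu y u) s) ∷ s)
  SCEnv-mu y u g sc gu du = SC-sub (mu y u) g sc gu du ∷ g

  mutual
    Guarded-mclo : ∀ (u : Tm) {s : Sb} → SCEnv s → InScope u s → Guarded u → Distinct u →
                   Guarded (mclo u s)
    Guarded-mclo end g sc h d = tt
    Guarded-mclo (var _) g sc h d = tt
    Guarded-mclo (inT _ u) g sc h d = Guarded-mclo u g (sc ∘ fv-inT) h d
    Guarded-mclo (outT _ u) g sc h d = Guarded-mclo u g (sc ∘ fv-outT) h d
    Guarded-mclo (inS m u) g sc (hm , hu) (_ , du) =
      Guarded-sub m g hm , Guarded-mclo u g (sc ∘ fv-inS₂) hu du
    Guarded-mclo (outS m u) g sc (hm , hu) (_ , du) =
      Guarded-sub m g hm , Guarded-mclo u g (sc ∘ fv-outS₂) hu du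
    Guarded-mclo (ext l u as) g sc (hu , has) (_ , du , das) =
      Guarded-mclo u g (sc ∘ fv-ext₁) hu du , GuardedA-mclo as g (sc ∘ fv-ext₂) has das
    Guarded-mclo (int l u as) g sc (hu , has) (_ , du , das) =
      Guarded-mclo u g (sc ∘ fv-int₁) hu du , GuardedA-mclo as g (sc ∘ fv-int₂) has das
    Guarded-mclo (mu y u) {s} g sc h@(¬ung , hu) d =
      ¬ung ∘ Unguarded-mclo u _ ,
      Guarded-mclo u (SCEnv-mu y u g sc h d) (InScope-mu y u (sub (mu y u) s) sc) hu d

    GuardedA-mclo : ∀ (as : Alts BT L) {s : Sb} → SCEnv s → InScopeA as s →
                    GuardedA as → DistinctA as → GuardedA (mcloA as s)
    GuardedA-mclo [] g sc h d = tt
    GuardedA-mclo (alt l u as) g sc (hu , has) (du , das) =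
      Guarded-mclo u g (sc ∘ fva-here) hu du , GuardedA-mclo as g (sc ∘ fva-there) has das

  mutual
    Distinct-mclo : ∀ (u : Tm) {s : Sb} → SCEnv s → InScope u s → Guarded u → Distinct u →
                    Distinct (mclo u s)
    Distinct-mclo end g sc h d = tt
    Distinct-mclo (var _) g sc h d = tt
    Distinct-mclo (inT _ u) g sc h d = Distinct-mclo u g (sc ∘ fv-inT) h d
    Distinct-mclo (outT _ u) g sc h d = Distinct-mclo u g (sc ∘ fv-outT) h d
    Distinct-mclo (inS m u) g sc (_ , hu) (dm , du) =
      Distinct-sub m g dm , Distinct-mclo u g (sc ∘ fv-inS₂) hu du
    Distinct-mclo (outS m u) g sc (_ , hu) (dm , du) =
      Distinct-sub m g dm , Distinct-mclo u g (sc ∘ fv-outS₂) hu du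
    Distinct-mclo (ext l u as) {s} g sc (hu , has) (uq , du , das) =
      subst (Unique ∘ (l ∷_)) (sym (labels-mcloA as s)) uq ,
      Distinct-mclo u g (sc ∘ fv-ext₁) hu du , DistinctA-mclo as g (sc ∘ fv-ext₂) has das
    Distinct-mclo (int l u as) {s} g sc (hu , has) (uq , du , das) =
      subst (Unique ∘ (l ∷_)) (sym (labels-mcloA as s)) uq ,
      Distinct-mclo u g (sc ∘ fv-int₁) hu du , DistinctA-mclo as g (sc ∘ fv-int₂) has das
    Distinct-mclo (mu y u) {s} g sc h@(_ , hu) d =
      Distinct-mclo u (SCEnv-mu y u g sc h d) (InScope-mu y u (sub (mu y u) s) sc) hu d

    DistinctA-mclo : ∀ (as : Alts BT L) {s : Sb} → SCEnv s → InScopeA as s →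
                     GuardedA as → DistinctA as → DistinctA (mcloA as s)
    DistinctA-mclo [] g sc h d = tt
    DistinctA-mclo (alt l u as) g sc (hu , has) (du , das) =
      Distinct-mclo u g (sc ∘ fva-here) hu du , DistinctA-mclo as g (sc ∘ fva-there) has das

  SC-mcl : ∀ (σ : Tm) → SC σ → SC (mcl σ)
  SC-mcl σ (c , g , d) =
    Closed-mcl c , Guarded-mclo σ [] (Closed⇒InScope [] c) g d , Distinct-mclo σ [] (Closed⇒InScope [] c) g d

  -- The values of s are closed, so the substitution of c for x leaves them unchanged.
  mutual
    sub-cons : ∀ (u : Tm) x (c : Tm) (s : Sb) → SCEnv s →
               sub (sub u (removeS x s)) ((x , c) ∷ []) ≡ sub u ((x , c) ∷ s)
    sub-cons end x c s g = refl
    sub-cons (inT b u) x c s g = cong (inT b) (sub-cons u x c s g)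
    sub-cons (outT b u) x c s g = cong (outT b) (sub-cons u x c s g)
    sub-cons (inS m u) x c s g = cong₂ inS (sub-cons m x c s g) (sub-cons u x c s g)
    sub-cons (outS m u) x c s g = cong₂ outS (sub-cons m x c s g) (sub-cons u x c s g)
    sub-cons (ext l u as) x c s g = cong₂ (ext l) (sub-cons u x c s g) (subA-cons as x c s g)
    sub-cons (int l u as) x c s g = cong₂ (int l) (sub-cons u x c s g) (subA-cons as x c s g)
    sub-cons (mu y u) x c s g with y ≟ x
    ... | yes refl = cong (mu y) (trans (sub-[] _) (cong (sub u) (remove-idem y s)))
    ... | no _ = cong (mu y) (trans (cong (λ r → sub (sub u r) ((x , c) ∷ [])) (remove-comm x y s))
                                     (sub-cons u x c (removeS y s) (remove-All y g)))
    sub-cons (var z) x c s g with z ≟ x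
    ... | yes refl =
      trans (cong (λ w → sub w ((z , c) ∷ [])) (sub-var-nothing (removeS z s) (lookup-remove-self z s)))
            (sub-var-here z c [])
    ... | no z≢x with lookupS s z in eq
    ...   | just v =
      trans (cong (λ w → sub w ((x , c) ∷ []))
                  (sub-var-just (removeS x s) (trans (lookup-remove-other s z≢x) eq)))
            (sub-closed ((x , c) ∷ []) (proj₁ (lookup-All g eq)))
    ...   | nothing =
      trans (cong (λ w → sub w ((x , c) ∷ []))
                  (sub-var-nothing (removeS x s) (trans (lookup-remove-other s z≢x) eq)))
            (sub-var-there c [] z≢x)

    subA-cons : ∀ (as : Alts BT L) x (c : Tm) (s : Sb) → SCEnv s →
                subA (subA as (removeS x s)) ((x , c) ∷ []) ≡ subA as ((x , c) ∷ s)
    subA-cons [] x c s g = refl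
    subA-cons (alt l u as) x c s g = cong₂ (alt l) (sub-cons u x c s g) (subA-cons as x c s g)

  data EnvCorr : Sb → Sb → Set where
    [] : EnvCorr [] []
    bind : ∀ {s t} x ρ → EnvCorr s t → SC (sub (mu x ρ) s) → SC (sub (mclo (mu x ρ) s) t) →
           EnvCorr ((x , sub (mu x ρ) s) ∷ s) ((x , sub (mclo (mu x ρ) s) t) ∷ t)

  EnvCorr-SCEnvˡ : ∀ {s t} → EnvCorr s t → SCEnv s
  EnvCorr-SCEnvˡ [] = []
  EnvCorr-SCEnvˡ (bind x ρ c sa sb) = sa ∷ EnvCorr-SCEnvˡ c

  EnvCorr-SCEnvʳ : ∀ {s t} → EnvCorr s t → SCEnv t
  EnvCorr-SCEnvʳ [] = []
  EnvCorr-SCEnvʳ (bind x ρ c sa sb) = sb ∷ EnvCorr-SCEnvʳ c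

  data VarView (s t : Sb) (z : ℕ) : Set where
    unbound : sub (var z) s ≡ var z → sub (var z) t ≡ var z → VarView s t z
    bound   : ∀ ρ {sx tx} → EnvCorr sx tx → SC (sub (mu z ρ) sx) → SC (sub (mclo (mu z ρ) sx) tx) →
              sub (var z) s ≡ sub (mu z ρ) sx → sub (var z) t ≡ sub (mclo (mu z ρ) sx) tx → VarView s t z

  var-view : ∀ {s t} → EnvCorr s t → ∀ z → VarView s t z
  var-view [] z = unbound refl refl
  var-view (bind {s} {t} x ρ c sa sb) z with z ≟ x
  ... | yes refl = bound ρ c sa sb (sub-var-here z _ s) (sub-var-here z _ t)
  ... | no z≢x with var-view c z
  ...   | unbound e₁ e₂ =
    unbound (trans (sub-var-there _ s z≢x) e₁) (trans (sub-var-there _ t z≢x) e₂)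
  ...   | bound ρ′ c′ sa′ sb′ e₁ e₂ =
    bound ρ′ c′ sa′ sb′ (trans (sub-var-there _ s z≢x) e₁) (trans (sub-var-there _ t z≢x) e₂)

  data MclPair : Tm → Tm → Set where
    pair : ∀ ρ {s t} → EnvCorr s t → MclPair (sub ρ s) (sub (mclo ρ s) t)

  unfoldings-MclPair : ∀ x ρ {s t a′ b′ μ μ′} → EnvCorr s t →
                       SC (sub (mu x ρ) s) → SC (sub (mclo (mu x ρ) s) t) →
                       sub (mu x ρ) s ⟶[ μ ] a′ → sub (mclo (mu x ρ) s) t ⟶[ μ′ ] b′ → MclPair a′ b′
  unfoldings-MclPair x ρ {s} {t} c sa sb t-mu t-mu =
    subst₂ MclPair (sym (sub-cons ρ x _ s (EnvCorr-SCEnvˡ c)))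
                   (sym (sub-cons (mclo ρ ((x , sub (mu x ρ) s) ∷ s)) x _ t (EnvCorr-SCEnvʳ c)))
                   (pair ρ (bind x ρ c sa sb))

  mu-fwd : ∀ x ρ {s t a′ μ} → EnvCorr s t → SC (sub (mu x ρ) s) → SC (sub (mclo (mu x ρ) s) t) →
           sub (mu x ρ) s ⟶[ μ ] a′ → ∃ λ b′ → (sub (mclo (mu x ρ) s) t ⟶[ μ ] b′) × MclPair a′ b′
  mu-fwd x ρ c sa sb t-mu = _ , t-mu , unfoldings-MclPair x ρ c sa sb t-mu t-mu

  mu-bwd : ∀ x ρ {s t b′ μ} → EnvCorr s t → SC (sub (mu x ρ) s) → SC (sub (mclo (mu x ρ) s) t) →
           sub (mclo (mu x ρ) s) t ⟶[ μ ] b′ → ∃ λ a′ → (sub (mu x ρ) s ⟶[ μ ] a′) × MclPair a′ b′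
  mu-bwd x ρ c sa sb t-mu = _ , t-mu , unfoldings-MclPair x ρ c sa sb t-mu t-mu

  var-stuck : ∀ {z μ} {a′ : Tm} → ¬ (var z ⟶[ μ ] a′)
  var-stuck ()

  MclPair-fwd : ∀ {a b a′ μ} → MclPair a b → SC a → SC b → a ⟶[ μ ] a′ →
                ∃ λ b′ → (b ⟶[ μ ] b′) × MclPair a′ b′
  MclPair-fwd (pair (inT _ ρ) c) _ _ t-inT = _ , t-inT , pair ρ c
  MclPair-fwd (pair (outT _ ρ) c) _ _ t-outT = _ , t-outT , pair ρ c
  MclPair-fwd (pair (inS m ρ) {s} {t} c) (cl , _) _ t-inS =
    _ , subst (λ m′ → sub (mclo (inS m ρ) s) t ⟶[ act (inSe m′) ] sub (mclo ρ s) t)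
              (sub-closed t (λ x → cl x ∘ fv-inS₁)) t-inS ,
    pair ρ c
  MclPair-fwd (pair (outS m ρ) {s} {t} c) (cl , _) _ t-outS =
    _ , subst (λ m′ → sub (mclo (outS m ρ) s) t ⟶[ act (outSe m′) ] sub (mclo ρ s) t)
              (sub-closed t (λ x → cl x ∘ fv-outS₁)) t-outS ,
    pair ρ c
  MclPair-fwd (pair (ext l ρ as) c) _ _ t-ext-head = _ , t-ext-head , pair ρ c
  MclPair-fwd (pair (ext l ρ as) c) _ _ (t-ext-tail i) with InAlts-subA⁻ as i
  ... | ρ′ , j , refl = _ , t-ext-tail (InAlts-subA (InAlts-mcloA j)) , pair ρ′ c
  MclPair-fwd (pair (int l ρ []) c) _ _ t-out = _ , t-out , pair ρ c
  MclPair-fwd (pair (int l ρ (alt _ _ _)) c) _ _ t-int-head = _ , t-int-head , pair (int l ρ []) c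
  MclPair-fwd (pair (int l ρ as@(alt _ _ _)) c) _ _ (t-int-tail i) with InAlts-subA⁻ as i
  ... | ρ′ , j , refl = _ , t-int-tail (InAlts-subA (InAlts-mcloA j)) , pair (int _ ρ′ []) c
  MclPair-fwd (pair (mu x ρ) c) sa sb st = mu-fwd x ρ c sa sb st
  MclPair-fwd (pair (var z) c) _ _ st with var-view c z
  ... | unbound e₁ _ = contradiction (subst (_⟶[ _ ] _) e₁ st) var-stuck
  ... | bound ρ c′ sa sb e₁ e₂ =
    Prod.map₂ (Prod.map₁ (subst (_⟶[ _ ] _) (sym e₂))) (mu-fwd _ ρ c′ sa sb (subst (_⟶[ _ ] _) e₁ st))

  MclPair-bwd : ∀ {a b b′ μ} → MclPair a b → SC a → SC b → b ⟶[ μ ] b′ →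
                ∃ λ a′ → (a ⟶[ μ ] a′) × MclPair a′ b′
  MclPair-bwd (pair (inT _ ρ) c) _ _ t-inT = _ , t-inT , pair ρ c
  MclPair-bwd (pair (outT _ ρ) c) _ _ t-outT = _ , t-outT , pair ρ c
  MclPair-bwd (pair (inS m ρ) {s} {t} c) (cl , _) _ t-inS =
    _ , subst (λ m′ → sub (inS m ρ) s ⟶[ act (inSe m′) ] sub ρ s)
              (sym (sub-closed t (λ x → cl x ∘ fv-inS₁))) t-inS ,
    pair ρ c
  MclPair-bwd (pair (outS m ρ) {s} {t} c) (cl , _) _ t-outS =
    _ , subst (λ m′ → sub (outS m ρ) s ⟶[ act (outSe m′) ] sub ρ s)
              (sym (sub-closed t (λ x → cl x ∘ fv-outS₁))) t-outS ,
    pair ρ c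
  MclPair-bwd (pair (ext l ρ as) c) _ _ t-ext-head = _ , t-ext-head , pair ρ c
  MclPair-bwd (pair (ext l ρ as) c) _ _ (t-ext-tail i) with InAlts-subA⁻ (mcloA as _) i
  ... | _ , j , refl with InAlts-mcloA⁻ as j
  ...   | ρ′ , k , refl = _ , t-ext-tail (InAlts-subA k) , pair ρ′ c
  MclPair-bwd (pair (int l ρ []) c) _ _ t-out = _ , t-out , pair ρ c
  MclPair-bwd (pair (int l ρ (alt _ _ _)) c) _ _ t-int-head = _ , t-int-head , pair (int l ρ []) c
  MclPair-bwd (pair (int l ρ as@(alt _ _ _)) c) _ _ (t-int-tail i) with InAlts-subA⁻ (mcloA as _) i
  ... | _ , j , refl with InAlts-mcloA⁻ as j
  ...   | ρ′ , k , refl = _ , t-int-tail (InAlts-subA k) , pair (int _ ρ′ []) c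
  MclPair-bwd (pair (mu x ρ) c) sa sb st = mu-bwd x ρ c sa sb st
  MclPair-bwd (pair (var z) c) _ _ st with var-view c z
  ... | unbound _ e₂ = contradiction (subst (_⟶[ _ ] _) e₂ st) var-stuck
  ... | bound ρ c′ sa sb e₁ e₂ =
    Prod.map₂ (Prod.map₁ (subst (_⟶[ _ ] _) (sym e₁))) (mu-bwd _ ρ c′ sa sb (subst (_⟶[ _ ] _) e₂ st))

  MclPair-Ok : ∀ {a b} → MclPair a b → Ok a → Ok b
  MclPair-Ok (pair end c) _ = ok-end
  MclPair-Ok (pair (var z) c) ok with var-view c z
  ... | unbound e₁ _ = contradiction (subst Ok e₁ ok) λ ()
  ... | bound _ _ _ _ e₁ _ = contradiction (subst Ok e₁ ok) λ ()
  MclPair-Ok (pair (inT _ _) _) ()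
  MclPair-Ok (pair (outT _ _) _) ()
  MclPair-Ok (pair (inS _ _) _) ()
  MclPair-Ok (pair (outS _ _) _) ()
  MclPair-Ok (pair (ext _ _ _) _) ()
  MclPair-Ok (pair (int _ _ _) _) ()
  MclPair-Ok (pair (mu _ _) _) ()

  MclPair-Ok⁻ : ∀ {a b} → MclPair a b → Ok b → Ok a
  MclPair-Ok⁻ (pair end c) _ = ok-end
  MclPair-Ok⁻ (pair (var z) c) ok with var-view c z
  ... | unbound _ e₂ = contradiction (subst Ok e₂ ok) λ ()
  ... | bound _ _ _ _ _ e₂ = contradiction (subst Ok e₂ ok) λ ()
  MclPair-Ok⁻ (pair (inT _ _) _) ()
  MclPair-Ok⁻ (pair (outT _ _) _) ()
  MclPair-Ok⁻ (pair (inS _ _) _) ()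
  MclPair-Ok⁻ (pair (outS _ _) _) ()
  MclPair-Ok⁻ (pair (ext _ _ _) _) ()
  MclPair-Ok⁻ (pair (int _ _ _) _) ()
  MclPair-Ok⁻ (pair (mu _ _) _) ()

  MclBisim : Tm → Tm → Set
  MclBisim a b = SC a × SC b × MclPair a b

  MclBisim-fwd : ∀ {a b a′ μ} → MclBisim a b → a ⟶[ μ ] a′ →
                 ∃ λ b′ → (b ⟶[ μ ] b′) × MclBisim a′ b′
  MclBisim-fwd (sa , sb , p) st with MclPair-fwd p sa sb st
  ... | b′ , st′ , p′ = b′ , st′ , step-preserves-SC sa st , step-preserves-SC sb st′ , p′

  MclBisim-bwd : ∀ {a b b′ μ} → MclBisim a b → b ⟶[ μ ] b′ →
                 ∃ λ a′ → (a ⟶[ μ ] a′) × MclBisim a′ b′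
  MclBisim-bwd (sa , sb , p) st with MclPair-bwd p sa sb st
  ... | a′ , st′ , p′ = a′ , st′ , step-preserves-SC sa st′ , step-preserves-SC sb st , p′

  MclBisim-isStrongBisim : IsStrongBisim MclBisim
  MclBisim-isStrongBisim = record
    { inSC = λ r → proj₁ r , proj₁ (proj₂ r)
    ; okL  = MclPair-Ok ∘ proj₂ ∘ proj₂
    ; okR  = MclPair-Ok⁻ ∘ proj₂ ∘ proj₂
    ; fwd  = MclBisim-fwd
    ; bwd  = MclBisim-bwd
    }

proposition5p15 : {BT L : Set} (σ : Term BT L) → SC σ → σ ∼ mcl σ
proposition5p15 σ sc =
  MclBisim , MclBisim-isStrongBisim ,
  sc , SC-mcl σ sc , subst₂ MclPair (sub-[] σ) (sub-[] (mcl σ)) (pair σ [])
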